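{- Let $\phi$ be a multi-modal formula and $p$ a propositional variable. Over the class of all Kripke models, $\phi$ is continuous in $p$ if and only if $\phi$ is strongly continuous in $p$, i.e., $\phi$ is $n$-continuous in $p$ for some $n\in\mathbb{N}$.
   Context: Multi-modal formulas are interpreted on Kripke models $M=(W,(R_a)_{a\in A},V)$; $M[p\mapsto X]$ is $M$ with the valuation of $p$ changed to $X$. $\phi$ is continuous in $p$ if for all pointed Kripke models $(M,w)$: $M,w\models\phi$ iff there is a finite set $X\subseteq V(p)$ with $M[p\mapsto X],w\models\phi$. For $n\in\mathbb N$, $\phi$ is $n$-continuous in $p$ if for all pointed Kripke models $(M,w)$: $M,w\models\phi$ iff there is a set $X\subseteq V(p)$ with $|X|\le n$ and $M[p\mapsto X],w\models\phi$. -}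

module Defs where

open import Data.Nat using (ℕ; _≤_; _≟_)
open import Data.List using (List; length)
open import Data.List.Membership.Propositional using (_∈_)
open import Data.List.Relation.Unary.All using (All)
open import Data.Product using (Σ; ∃; _×_)
open import Data.Sum using (_⊎_)
open import Data.Empty using (⊥)
open import Data.Unit using (⊤)
open import Relation.Nullary using (¬_; yes; no)

data Form (A : Set) : Set where
  var  : ℕ → Form A
  ⊤'   : Form A
  ⊥'   : Form A
  ¬'_  : Form A → Form A
  _∧'_ : Form A → Form A → Form A
  _∨'_ : Form A → Form A → Form A
  _⇒'_ : Form A → Form A → Form A
  □    : A → Form A → Form A
  ◇    : A → Form A → Form A

record Model (A : Set) (W : Set) : Set₁ where
  field
    R : A → W → W → Set
    V : ℕ → W → Set
open Model public

_,_⊨_ : {A W : Set} → Model A W → W → Form A → Set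
M , w ⊨ var q   = V M q w
M , w ⊨ ⊤'      = ⊤
M , w ⊨ ⊥'      = ⊥
M , w ⊨ (¬' φ)  = ¬ (M , w ⊨ φ)
M , w ⊨ (φ ∧' ψ) = (M , w ⊨ φ) × (M , w ⊨ ψ)
M , w ⊨ (φ ∨' ψ) = (M , w ⊨ φ) ⊎ (M , w ⊨ ψ)
M , w ⊨ (φ ⇒' ψ) = (M , w ⊨ φ) → (M , w ⊨ ψ)
M , w ⊨ □ a φ   = ∀ v → R M a w v → M , v ⊨ φ
M , w ⊨ ◇ a φ   = Σ _ λ v → R M a w v × (M , v ⊨ φ)

-- M[p ↦ X] for a finite set X, given as a list of worlds
_[_↦_] : {A W : Set} → Model A W → ℕ → List W → Model A W
R (M [ p ↦ X ]) = R M
V (M [ p ↦ X ]) q with q ≟ p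
... | yes _ = λ w → w ∈ X
... | no  _ = V M q

Continuous : {A : Set} → Form A → ℕ → Set₁
Continuous {A} φ p =
  ∀ (W : Set) (M : Model A W) (w : W) →
    ((M , w ⊨ φ) → Σ (List W) λ X → All (V M p) X × ((M [ p ↦ X ]) , w ⊨ φ))
  × ((Σ (List W) λ X → All (V M p) X × ((M [ p ↦ X ]) , w ⊨ φ)) → M , w ⊨ φ)

-- φ is n-continuous in p (a list of length ≤ n represents a set of size ≤ n)
NContinuous : {A : Set} → ℕ → Form A → ℕ → Set₁
NContinuous {A} n φ p =
  ∀ (W : Set) (M : Model A W) (w : W) →
    ((M , w ⊨ φ) → Σ (List W) λ X → length X ≤ n × All (V M p) X × ((M [ p ↦ X ]) , w ⊨ φ))
  × ((Σ (List W) λ X → length X ≤ n × All (V M p) X × ((M [ p ↦ X ]) , w ⊨ φ)) → M , w ⊨ φ)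

StronglyContinuous : {A : Set} → Form A → ℕ → Set₁
StronglyContinuous φ p = Σ ℕ λ n → NContinuous n φ p

-- Strong continuity gives continuity: a finite X with M[p ↦ X], w ⊨ φ is shrunk further by
-- applying n-continuity to M[p ↦ X]. Conversely, continuity makes φ monotone in p. Unravel
-- (M, w) into a tree T in which every edge is copied infinitely often and let Y be the finite
-- set of p-nodes that continuity provides for T. Using excluded middle, pick at every node,
-- for each modal subformula ◇χ (resp. □χ) of φ, one successor satisfying (resp. refuting) χ
-- in T[p ↦ Y]. Keeping only the nodes of Y reached by picked edges within the modal depth d
-- of φ does not change the truth of φ at the root: an unpicked successor and a fresh copy of
-- the same edge, whose subtree avoids Y, both behave like M with p empty. At most
-- Σ_{k ≤ d} m^k nodes are kept (m the number of modal subformulas), and by monotonicity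
-- their images in M form the required set.

{-# OPTIONS --safe #-}
module Submission where

open import Defs
open import Axiom.ExcludedMiddle using (ExcludedMiddle)
open import Level using (0ℓ)
open import Data.Nat using (ℕ; zero; suc; _+_; _*_; _⊔_; _≤_; _≟_; z≤n; s≤s)
open import Data.Nat.Properties
  using ( ≤-refl; ≤-trans; ≤-reflexive; +-mono-≤; +-monoʳ-≤; *-monoˡ-≤; *-identityʳ; +-suc
        ; m≤m⊔n; m≤n⊔m; m+n≤o⇒m≤o; 1+n≰n)
open import Data.List using (List; []; _∷_; _++_; _∷ʳ_; length; map; concat; concatMap; filter)
open import Data.List.Properties using (∷ʳ-++; length-++; length-map; length-filter)
open import Data.List.Extrema.Nat using (max; xs≤max)
open import Data.List.Membership.Propositional using (_∈_; _∉_)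
open import Data.List.Membership.Propositional.Properties using (∈-++⁺ʳ; ∈-map⁺; ∈-concat⁺′; ∈-filter⁺)
open import Data.List.Relation.Unary.Any using (here; there)
open import Data.List.Relation.Unary.All as All using (All)
open import Data.List.Relation.Unary.All.Properties using (all-filter)
open import Data.List.Relation.Binary.Subset.Propositional using (_⊆_)
open import Data.List.Relation.Binary.Subset.Propositional.Properties using (xs⊆xs++ys; xs⊆ys++xs)
open import Data.Product using (Σ; ∃; _×_; _,_; proj₁; proj₂; map₂)
open import Data.Product.Function.NonDependent.Propositional using (_×-⇔_)
open import Data.Sum.Function.Propositional using (_⊎-⇔_)
open import Data.Unit using (⊤; tt)
open import Data.Empty using (⊥; ⊥-elim)
open import Function using (_∘_; id; _⇔_; mk⇔; Equivalence)
open import Function.Construct.Identity using (⇔-id)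
open import Function.Construct.Symmetry using (⇔-sym)
open import Function.Construct.Composition using (_⇔-∘_)
open import Function.Related.TypeIsomorphisms using (→-cong-⇔; ¬-cong-⇔)
open import Relation.Nullary using (¬_; Dec; yes; no; contradiction)
open import Relation.Unary using (∅; Decidable)
open import Relation.Binary.PropositionalEquality as ≡ using (_≡_; _≢_; refl; subst)

open Equivalence using (to; from)

record Bisimulation {A W W′ : Set} (M : Model A W) (N : Model A W′) : Set₁ where
  field
    Z     : W → W′ → Set
    atoms : ∀ {x y} → Z x y → ∀ q → V M q x ⇔ V N q y
    forth : ∀ {a x y x′} → Z x y → R M a x x′ → Σ W′ λ y′ → R N a y y′ × Z x′ y′
    back  : ∀ {a x y y′} → Z x y → R N a y y′ → Σ W λ x′ → R M a x x′ × Z x′ y′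

module _ {A W W′ : Set} {M : Model A W} {N : Model A W′} (B : Bisimulation M N) where
  open Bisimulation B

  bisimilar⇒⊨⇔ : ∀ {x y} → Z x y → ∀ φ → M , x ⊨ φ ⇔ N , y ⊨ φ
  bisimilar⇒⊨⇔ xZy (var q)  = atoms xZy q
  bisimilar⇒⊨⇔ xZy ⊤'       = ⇔-id _
  bisimilar⇒⊨⇔ xZy ⊥'       = ⇔-id _
  bisimilar⇒⊨⇔ xZy (¬' φ)   = ¬-cong-⇔ (bisimilar⇒⊨⇔ xZy φ)
  bisimilar⇒⊨⇔ xZy (φ ∧' ψ) = bisimilar⇒⊨⇔ xZy φ ×-⇔ bisimilar⇒⊨⇔ xZy ψ
  bisimilar⇒⊨⇔ xZy (φ ∨' ψ) = bisimilar⇒⊨⇔ xZy φ ⊎-⇔ bisimilar⇒⊨⇔ xZy ψ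
  bisimilar⇒⊨⇔ xZy (φ ⇒' ψ) = →-cong-⇔ (bisimilar⇒⊨⇔ xZy φ) (bisimilar⇒⊨⇔ xZy ψ)
  bisimilar⇒⊨⇔ {x} {y} xZy (□ a φ) = mk⇔ □-forth □-back
    where
    □-forth : M , x ⊨ □ a φ → N , y ⊨ □ a φ
    □-forth h y′ yRy′ with back xZy yRy′
    ... | x′ , xRx′ , x′Zy′ = to (bisimilar⇒⊨⇔ x′Zy′ φ) (h x′ xRx′)
    □-back : N , y ⊨ □ a φ → M , x ⊨ □ a φ
    □-back h x′ xRx′ with forth xZy xRx′
    ... | y′ , yRy′ , x′Zy′ = from (bisimilar⇒⊨⇔ x′Zy′ φ) (h y′ yRy′)
  bisimilar⇒⊨⇔ {x} {y} xZy (◇ a φ) = mk⇔ ◇-forth ◇-back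
    where
    ◇-forth : M , x ⊨ ◇ a φ → N , y ⊨ ◇ a φ
    ◇-forth (x′ , xRx′ , s) with forth xZy xRx′
    ... | y′ , yRy′ , x′Zy′ = y′ , yRy′ , to (bisimilar⇒⊨⇔ x′Zy′ φ) s
    ◇-back : N , y ⊨ ◇ a φ → M , x ⊨ ◇ a φ
    ◇-back (y′ , yRy′ , s) with back xZy yRy′
    ... | x′ , xRx′ , x′Zy′ = x′ , xRx′ , from (bisimilar⇒⊨⇔ x′Zy′ φ) s

⊨-cong-V : ∀ {A W} (Rel : A → W → W → Set) {U U′ : ℕ → W → Set} → (∀ q x → U q x ⇔ U′ q x) →
           ∀ φ {w} → record { R = Rel ; V = U } , w ⊨ φ ⇔ record { R = Rel ; V = U′ } , w ⊨ φ
⊨-cong-V Rel {U} {U′} U⇔U′ φ = bisimilar⇒⊨⇔ identity refl φ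
  where
  identity : Bisimulation record { R = Rel ; V = U } record { R = Rel ; V = U′ }
  identity = record
    { Z     = _≡_
    ; atoms = λ { refl q → U⇔U′ q _ }
    ; forth = λ { refl r → _ , r , refl }
    ; back  = λ { refl r → _ , r , refl }
    }

_[_≔_] : ∀ {A W} → Model A W → ℕ → (W → Set) → Model A W
R (M [ p ≔ P ]) = R M
V (M [ p ≔ P ]) q with q ≟ p
... | yes _ = P
... | no  _ = V M q

module _ {A W : Set} (M : Model A W) (p : ℕ) where

  ↦-at-p : ∀ X {x} → V (M [ p ↦ X ]) p x ⇔ x ∈ X
  ↦-at-p X with p ≟ p
  ... | yes _   = ⇔-id _
  ... | no p≢p = contradiction refl p≢p

  ↦-off-p : ∀ X {q x} → q ≢ p → V (M [ p ↦ X ]) q x ⇔ V M q x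
  ↦-off-p X {q} q≢p with q ≟ p
  ... | yes q≡p = contradiction q≡p q≢p
  ... | no _    = ⇔-id _

  ≔-at-p : ∀ P {x} → V (M [ p ≔ P ]) p x ⇔ P x
  ≔-at-p P with p ≟ p
  ... | yes _   = ⇔-id _
  ... | no p≢p = contradiction refl p≢p

  ≔-off-p : ∀ P {q x} → q ≢ p → V (M [ p ≔ P ]) q x ⇔ V M q x
  ≔-off-p P {q} q≢p with q ≟ p
  ... | yes q≡p = contradiction q≡p q≢p
  ... | no _    = ⇔-id _

  ↦⇔≔∈ : ∀ X q x → V (M [ p ↦ X ]) q x ⇔ V (M [ p ≔ (_∈ X) ]) q x
  ↦⇔≔∈ X q x with q ≟ p
  ... | yes _ = ⇔-id _
  ... | no _  = ⇔-id _

module _ {A W : Set} (N K : Model A W) (p : ℕ) where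

  ↦-cong-off-p : ∀ X → (∀ {q x} → q ≢ p → V N q x ⇔ V K q x) →
                 ∀ q x → V (N [ p ↦ X ]) q x ⇔ V (K [ p ↦ X ]) q x
  ↦-cong-off-p X N⇔K q x with q ≟ p
  ... | yes _   = ⇔-id _
  ... | no q≢p = N⇔K q≢p

module _ {A W W′ : Set} (N : Model A W) (K : Model A W′) (p : ℕ) where

  ≔-cong : ∀ {P Q x y} → (∀ q → V N q x ⇔ V K q y) → P x ⇔ Q y →
           ∀ q → V (N [ p ≔ P ]) q x ⇔ V (K [ p ≔ Q ]) q y
  ≔-cong N⇔K P⇔Q q with q ≟ p
  ... | yes _ = P⇔Q
  ... | no _  = N⇔K q

chosen : {X : Set} {P : X → Set} → Dec (∃ P) → List X
chosen (yes (x , _)) = x ∷ []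
chosen (no _)        = []

chosen-complete : {X : Set} {P : X → Set} (d : Dec (∃ P)) → ∃ P → ∃ λ x → P x × x ∈ chosen d
chosen-complete (yes (x , px)) _ = x , px , here refl
chosen-complete (no ¬∃P)       ∃P = contradiction ∃P ¬∃P

length-chosen : {X : Set} {P : X → Set} (d : Dec (∃ P)) → length (chosen d) ≤ 1
length-chosen (yes _) = s≤s z≤n
length-chosen (no _)  = z≤n

length-concatMap-≤ : {X Y : Set} {f : X → List Y} {c : ℕ} → (∀ x → length (f x) ≤ c) →
                     ∀ xs → length (concatMap f xs) ≤ length xs * c
length-concatMap-≤         f≤c []       = z≤n
length-concatMap-≤ {f = f} f≤c (x ∷ xs) =
  subst (_≤ _) (≡.sym (length-++ (f x))) (+-mono-≤ (f≤c x) (length-concatMap-≤ f≤c xs))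

module Unravelling {A W : Set} (M : Model A W) (w : W) where

  Node : Set
  Node = List (A × ℕ × W)

  end : Node → W
  end []                = w
  end ((_ , _ , x) ∷ _) = x

  -- Every edge of M is copied once for each index i, so for any finite set of nodes some copy
  -- of a given edge leads to a subtree avoiding it (see freshIndex).
  data Edge (a : A) (u : Node) : Node → Set where
    edge : (i : ℕ) {x : W} → R M a (end u) x → Edge a u ((a , i , x) ∷ u)

  T : Model A Node
  R T = Edge
  V T q n = V M q (end n)

  end-bisimulation : {U : ℕ → Node → Set} {U′ : ℕ → W → Set} (I : Node → Set) →
                     (∀ {st n} → I n → I (st ∷ n)) → (∀ {n} → I n → ∀ q → U q n ⇔ U′ q (end n)) →
                     Bisimulation record { R = Edge ; V = U } record { R = R M ; V = U′ }
  end-bisimulation I I-child I-atoms = record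
    { Z     = λ n x → x ≡ end n × I n
    ; atoms = λ { (refl , i) → I-atoms i }
    ; forth = λ { (refl , i) (edge _ r) → _ , r , refl , I-child i }
    ; back  = λ { (refl , i) r → _ , edge 0 r , refl , I-child i }
    }

  unravel-⊨ : ∀ φ → T , [] ⊨ φ ⇔ M , w ⊨ φ
  unravel-⊨ = bisimilar⇒⊨⇔ (end-bisimulation (λ _ → ⊤) _ (λ _ _ → ⇔-id _)) (refl , tt)

  ≔-unravel-⊨ : ∀ p Q φ → (T [ p ≔ Q ∘ end ]) , [] ⊨ φ ⇔ (M [ p ≔ Q ]) , w ⊨ φ
  ≔-unravel-⊨ p Q = bisimilar⇒⊨⇔
    (end-bisimulation (λ _ → ⊤) _ (λ _ → ≔-cong T M p (λ _ → ⇔-id _) (⇔-id _))) (refl , tt)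

  NoneBelow : (Node → Set) → Node → Set
  NoneBelow P n = ∀ ext → ¬ P (ext ++ n)

  NoneBelow-child : ∀ {P n st} → NoneBelow P n → NoneBelow P (st ∷ n)
  NoneBelow-child {P} {n} {st} none ext = subst (¬_ ∘ P) (∷ʳ-++ ext st n) (none (ext ∷ʳ st))

  p-free-subtree : ∀ p {P n} → NoneBelow P n →
                   ∀ φ → (T [ p ≔ P ]) , n ⊨ φ ⇔ (M [ p ≔ ∅ ]) , end n ⊨ φ
  p-free-subtree p {P} none = bisimilar⇒⊨⇔
    (end-bisimulation (NoneBelow P) (NoneBelow-child {P})
      (λ none → ≔-cong T M p (λ _ → ⇔-id _) (mk⇔ (none []) ⊥-elim)))
    (refl , none)

  freshIndex : List Node → ℕ
  freshIndex Y = suc (max 0 (map (proj₁ ∘ proj₂) (concat Y)))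

  freshIndex-avoids : ∀ Y {a x u} → NoneBelow (_∈ Y) ((a , freshIndex Y , x) ∷ u)
  freshIndex-avoids Y ext n∈Y = 1+n≰n (All.lookup (xs≤max 0 _)
    (∈-map⁺ (proj₁ ∘ proj₂) (∈-concat⁺′ (∈-++⁺ʳ ext (here refl)) n∈Y)))

modalSubformulas : ∀ {A} → Form A → List (Form A)
modalSubformulas (var _)  = []
modalSubformulas ⊤'       = []
modalSubformulas ⊥'       = []
modalSubformulas (¬' φ)   = modalSubformulas φ
modalSubformulas (φ ∧' ψ) = modalSubformulas φ ++ modalSubformulas ψ
modalSubformulas (φ ∨' ψ) = modalSubformulas φ ++ modalSubformulas ψ
modalSubformulas (φ ⇒' ψ) = modalSubformulas φ ++ modalSubformulas ψ
modalSubformulas (□ a φ)  = □ a φ ∷ modalSubformulas φ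
modalSubformulas (◇ a φ)  = ◇ a φ ∷ modalSubformulas φ

modalDepth : ∀ {A} → Form A → ℕ
modalDepth (var _)  = 0
modalDepth ⊤'       = 0
modalDepth ⊥'       = 0
modalDepth (¬' φ)   = modalDepth φ
modalDepth (φ ∧' ψ) = modalDepth φ ⊔ modalDepth ψ
modalDepth (φ ∨' ψ) = modalDepth φ ⊔ modalDepth ψ
modalDepth (φ ⇒' ψ) = modalDepth φ ⊔ modalDepth ψ
modalDepth (□ a φ)  = suc (modalDepth φ)
modalDepth (◇ a φ)  = suc (modalDepth φ)

treeSize : ℕ → ℕ → ℕ
treeSize m zero    = 1
treeSize m (suc k) = suc (treeSize m k * m)

+-⊔-≤ˡ : ∀ l {m n o} → l + (m ⊔ n) ≤ o → l + m ≤ o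
+-⊔-≤ˡ l = ≤-trans (+-monoʳ-≤ l (m≤m⊔n _ _))

+-⊔-≤ʳ : ∀ l {m n o} → l + (m ⊔ n) ≤ o → l + n ≤ o
+-⊔-≤ʳ l = ≤-trans (+-monoʳ-≤ l (m≤n⊔m _ _))

+-suc-≤ : ∀ l {k o} → l + suc k ≤ o → suc l + k ≤ o
+-suc-≤ l {k} {o} = subst (_≤ o) (+-suc l k)

module Selection (lem : ExcludedMiddle 0ℓ) {A W : Set} (M : Model A W) (w : W) (p : ℕ)
                 (φ : Form A) (Y : List (Unravelling.Node M w)) where
  open Unravelling M w

  D : ℕ
  D = modalDepth φ

  MY : Model A Node
  MY = T [ p ≔ (_∈ Y) ]

  Witness : Node → Form A → Node → Set
  Witness u (□ a χ) v = Edge a u v × ¬ (MY , v ⊨ χ)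
  Witness u (◇ a χ) v = Edge a u v × MY , v ⊨ χ
  Witness u _       v = ⊥

  picks : Node → List Node
  picks u = concatMap (λ ψ → chosen (lem {∃ (Witness u ψ)})) (modalSubformulas φ)

  picks-witness : ∀ {u ψ} → ψ ∈ modalSubformulas φ → ∃ (Witness u ψ) →
                  ∃ λ v → Witness u ψ v × v ∈ picks u
  picks-witness ψ∈φ wit with chosen-complete lem wit
  ... | v , wv , v∈ = v , wv , ∈-concat⁺′ v∈ (∈-map⁺ _ ψ∈φ)

  length-picks : ∀ u → length (picks u) ≤ length (modalSubformulas φ)
  length-picks u = ≤-trans (length-concatMap-≤ (λ ψ → length-chosen lem) (modalSubformulas φ))
                           (≤-reflexive (*-identityʳ _))

  data Picked : Node → Set where
    root  : Picked []
    child : ∀ {st u} → Picked u → st ∷ u ∈ picks u → Picked (st ∷ u)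

  Picked-suffix : ∀ ext {n} → Picked (ext ++ n) → Picked n
  Picked-suffix []        pn           = pn
  Picked-suffix (_ ∷ ext) (child pn _) = Picked-suffix ext pn

  Kept : Node → Set
  Kept n = n ∈ Y × length n ≤ D × Picked n

  MKept : Model A Node
  MKept = T [ p ≔ Kept ]

  unpicked-unkept : ∀ {st u} → st ∷ u ∉ picks u → NoneBelow Kept (st ∷ u)
  unpicked-unkept st∉ ext (_ , _ , kept) with Picked-suffix ext kept
  ... | child _ st∈ = st∉ st∈

  unpicked≈fresh : ∀ {a i x u} → (a , i , x) ∷ u ∉ picks u → ∀ χ →
                   MKept , (a , i , x) ∷ u ⊨ χ ⇔ MY , (a , freshIndex Y , x) ∷ u ⊨ χ
  unpicked≈fresh v∉ χ =
    ⇔-sym (p-free-subtree p (freshIndex-avoids Y) χ) ⇔-∘ p-free-subtree p (unpicked-unkept v∉) χ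

  module _ {a χ u} (ih : ∀ {v} → Edge a u v → v ∈ picks u → MKept , v ⊨ χ ⇔ MY , v ⊨ χ) where

    agree-◇ : ◇ a χ ∈ modalSubformulas φ → MKept , u ⊨ ◇ a χ ⇔ MY , u ⊨ ◇ a χ
    agree-◇ ◇∈φ = mk⇔ forth back
      where
      forth : MKept , u ⊨ ◇ a χ → MY , u ⊨ ◇ a χ
      forth (v , e@(edge _ r) , s) with lem {v ∈ picks u}
      ... | yes v∈ = v , e , to (ih e v∈) s
      ... | no v∉  = _ , edge (freshIndex Y) r , to (unpicked≈fresh v∉ χ) s
      back : MY , u ⊨ ◇ a χ → MKept , u ⊨ ◇ a χ
      back s with picks-witness ◇∈φ s
      ... | v , (e , sv) , v∈ = v , e , from (ih e v∈) sv

    agree-□ : □ a χ ∈ modalSubformulas φ → MKept , u ⊨ □ a χ ⇔ MY , u ⊨ □ a χ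
    agree-□ □∈φ = mk⇔ forth back
      where
      forth : MKept , u ⊨ □ a χ → MY , u ⊨ □ a χ
      forth h v e with lem {MY , v ⊨ χ}
      ... | yes s = s
      ... | no ¬s with picks-witness □∈φ (v , e , ¬s)
      ...   | v′ , (e′ , ¬s′) , v′∈ = contradiction (to (ih e′ v′∈) (h v′ e′)) ¬s′
      back : MY , u ⊨ □ a χ → MKept , u ⊨ □ a χ
      back h v e@(edge _ r) with lem {v ∈ picks u}
      ... | yes v∈ = from (ih e v∈) (h v e)
      ... | no v∉  = from (unpicked≈fresh v∉ χ) (h _ (edge (freshIndex Y) r))

  agree : ∀ ψ {u} → modalSubformulas ψ ⊆ modalSubformulas φ → Picked u →
          length u + modalDepth ψ ≤ D → MKept , u ⊨ ψ ⇔ MY , u ⊨ ψ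
  agree (var q)  _  pu le =
    ≔-cong T T p (λ _ → ⇔-id _) (mk⇔ proj₁ (λ u∈Y → u∈Y , m+n≤o⇒m≤o _ le , pu)) q
  agree ⊤'       _  _  _  = ⇔-id _
  agree ⊥'       _  _  _  = ⇔-id _
  agree (¬' ψ)   ⊆φ pu le = ¬-cong-⇔ (agree ψ ⊆φ pu le)
  agree (ψ ∧' χ) {u} ⊆φ pu le = agree ψ (⊆φ ∘ xs⊆xs++ys _ _) pu (+-⊔-≤ˡ (length u) le)
                           ×-⇔ agree χ (⊆φ ∘ xs⊆ys++xs _ _) pu (+-⊔-≤ʳ (length u) le)
  agree (ψ ∨' χ) {u} ⊆φ pu le = agree ψ (⊆φ ∘ xs⊆xs++ys _ _) pu (+-⊔-≤ˡ (length u) le)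
                           ⊎-⇔ agree χ (⊆φ ∘ xs⊆ys++xs _ _) pu (+-⊔-≤ʳ (length u) le)
  agree (ψ ⇒' χ) {u} ⊆φ pu le = →-cong-⇔ (agree ψ (⊆φ ∘ xs⊆xs++ys _ _) pu (+-⊔-≤ˡ (length u) le))
                                        (agree χ (⊆φ ∘ xs⊆ys++xs _ _) pu (+-⊔-≤ʳ (length u) le))
  agree (□ a χ) {u} ⊆φ pu le = agree-□ (λ { (edge _ _) v∈ →
    agree χ (⊆φ ∘ there) (child pu v∈) (+-suc-≤ (length u) le) }) (⊆φ (here refl))
  agree (◇ a χ) {u} ⊆φ pu le = agree-◇ (λ { (edge _ _) v∈ →
    agree χ (⊆φ ∘ there) (child pu v∈) (+-suc-≤ (length u) le) }) (⊆φ (here refl))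

  Kept-suffices : (T [ p ↦ Y ]) , [] ⊨ φ → MKept , [] ⊨ φ
  Kept-suffices = from (agree φ id root ≤-refl) ∘ to (⊨-cong-V Edge (↦⇔≔∈ T p Y) φ)

  pickedUpTo : ℕ → List Node
  pickedUpTo zero    = [] ∷ []
  pickedUpTo (suc k) = [] ∷ concatMap picks (pickedUpTo k)

  Picked⇒∈pickedUpTo : ∀ {n k} → Picked n → length n ≤ k → n ∈ pickedUpTo k
  Picked⇒∈pickedUpTo {k = zero}  root           _         = here refl
  Picked⇒∈pickedUpTo {k = suc k} root           _         = here refl
  Picked⇒∈pickedUpTo {k = suc k} (child pu st∈) (s≤s len) =
    there (∈-concat⁺′ st∈ (∈-map⁺ picks (Picked⇒∈pickedUpTo pu len)))

  length-pickedUpTo : ∀ k → length (pickedUpTo k) ≤ treeSize (length (modalSubformulas φ)) k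
  length-pickedUpTo zero    = ≤-refl
  length-pickedUpTo (suc k) = s≤s (≤-trans (length-concatMap-≤ length-picks (pickedUpTo k))
                                           (*-monoˡ-≤ _ (length-pickedUpTo k)))

  p? : Decidable (V M p)
  p? _ = lem

  selected : List W
  selected = filter p? (map end (pickedUpTo D))

  length-selected : length selected ≤ treeSize (length (modalSubformulas φ)) D
  length-selected = ≤-trans (length-filter p? (map end (pickedUpTo D)))
    (subst (_≤ _) (≡.sym (length-map end (pickedUpTo D))) (length-pickedUpTo D))

  selected⊆p : All (V M p) selected
  selected⊆p = all-filter p? (map end (pickedUpTo D))

  Kept⇒selected : All (V T p) Y → ∀ {n} → Kept n → end n ∈ selected
  Kept⇒selected Y⊆p (n∈Y , len , pn) =
    ∈-filter⁺ p? (∈-map⁺ end (Picked⇒∈pickedUpTo pn len)) (All.lookup Y⊆p n∈Y)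

continuous⇒monotone : ∀ {A} (φ : Form A) p → Continuous φ p →
                      ∀ {W} (M : Model A W) {P P′ : W → Set} → (∀ {x} → P x → P′ x) →
                      ∀ {w} → (M [ p ≔ P ]) , w ⊨ φ → (M [ p ≔ P′ ]) , w ⊨ φ
continuous⇒monotone φ p C M {P} {P′} P⊆P′ {w} s with proj₁ (C _ (M [ p ≔ P ]) w) s
... | X , X⊆P , sX = proj₂ (C _ (M [ p ≔ P′ ]) w)
  ( X
  , All.map (from (≔-at-p M p P′) ∘ P⊆P′ ∘ to (≔-at-p M p P)) X⊆P
  , to (⊨-cong-V (R M) (↦-cong-off-p (M [ p ≔ P ]) (M [ p ≔ P′ ]) p X
         λ q≢p → ⇔-sym (≔-off-p M p P′ q≢p) ⇔-∘ ≔-off-p M p P q≢p) φ) sX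
  )

continuous⇒stronglyContinuous : ExcludedMiddle 0ℓ → ∀ {A} (φ : Form A) p →
                                Continuous φ p → StronglyContinuous φ p
continuous⇒stronglyContinuous lem {A} φ p C =
  treeSize (length (modalSubformulas φ)) (modalDepth φ) ,
  λ W M w → shrink M w , proj₂ (C W M w) ∘ map₂ proj₂
  where
  shrink : ∀ {W} (M : Model A W) w → M , w ⊨ φ →
           Σ (List W) λ X → length X ≤ treeSize (length (modalSubformulas φ)) (modalDepth φ)
                          × All (V M p) X × (M [ p ↦ X ]) , w ⊨ φ
  shrink M w s with proj₁ (C _ (Unravelling.T M w) []) (from (Unravelling.unravel-⊨ M w φ) s)
  ... | Y , Y⊆p , sY = selected , length-selected , selected⊆p ,
    from (⊨-cong-V (R M) (↦⇔≔∈ M p selected) φ)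
      (to (≔-unravel-⊨ p (_∈ selected) φ)
        (continuous⇒monotone φ p C T (Kept⇒selected Y⊆p) (Kept-suffices sY)))
    where
    open Unravelling M w
    open Selection lem M w p φ Y

stronglyContinuous⇒continuous : ∀ {A} (φ : Form A) p → StronglyContinuous φ p → Continuous φ p
stronglyContinuous⇒continuous φ p (n , nc) W M w = map₂ proj₂ ∘ proj₁ (nc W M w) , restore
  where
  restore : (Σ (List W) λ X → All (V M p) X × (M [ p ↦ X ]) , w ⊨ φ) → M , w ⊨ φ
  restore (X , X⊆p , sX) with proj₁ (nc W (M [ p ↦ X ]) w) sX
  ... | Y , Y≤n , Y⊆X , sY = proj₂ (nc W M w)
    ( Y
    , Y≤n
    , All.map (All.lookup X⊆p ∘ to (↦-at-p M p X)) Y⊆X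
    , to (⊨-cong-V (R M) (↦-cong-off-p (M [ p ↦ X ]) M p Y (↦-off-p M p X)) φ) sY
    )

proposition2p9 : ExcludedMiddle 0ℓ → (A : Set) (φ : Form A) (p : ℕ) →
    (Continuous φ p → StronglyContinuous φ p) × (StronglyContinuous φ p → Continuous φ p)
proposition2p9 lem A φ p = continuous⇒stronglyContinuous lem φ p , stronglyContinuous⇒continuous φ p
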